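{- Let $\mathtt{At}$ be a countable set of atomic formulas and $\Phi_0$ the set of Boolean formulas over $\mathtt{At}$. The modal axiom schema $$B(\phi>\phi)\qquad(\phi\in\Phi_0)$$ corresponds to (is characterized by) the following property of Kripke-Lewis frames $\langle S,\mathcal B,f\rangle$: $$(P\ast2)\qquad \forall s\in S,\ \forall E\in 2^S\setminus\{\varnothing\},\ \forall s'\in\mathcal B(s),\quad f(s',E)\subseteq E.$$ That is: (1) the schema is valid on every frame satisfying $(P\ast2)$, and (2) on every frame violating $(P\ast2)$ the schema is not valid.
   Context: $\Phi_0$ is built from $\mathtt{At}$ using $\neg$ and $\vee$ (with $\rightarrow,\wedge,\leftrightarrow$ defined as usual). A Kripke-Lewis frame is a triple $\langle S,\mathcal B,f\rangle$ where $S$ is a set of states, $\mathcal B\subseteq S\times S$ is a serial relation (for every $s$ there is $s'$ with $s\mathcal B s'$), $\mathcal B(s)=\{s':s\mathcal Bs'\}$, and $f:S\times(2^S\setminus\{\varnothing\})\to 2^S$ is an arbitrary function (no further properties are assumed). A model is a frame together with a valuation $V:\mathtt{At}\to 2^S$. Truth at a state $s$ of a model $M$: $s\models p$ iff $s\in V(p)$ for atoms; $\neg$ and $\vee$ are classical; $\Vert\phi\Vert=\{s:s\models\phi\}$. For $\phi\in\Phi_0$, $s\models\square\phi$ iff $\Vert\phi\Vert=S$. For $\phi,\psi\in\Phi_0$, $s\models\phi>\psi$ iff either $\Vert\phi\Vert=\varnothing$, or $\Vert\phi\Vert\neq\varnothing$ and $f(s,\Vert\phi\Vert)\subseteq\Vert\psi\Vert$.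 For $\phi$ a Boolean combination of formulas of $\Phi_0$ and of conditionals $\alpha>\beta$ with $\alpha,\beta\in\Phi_0$, $s\models B\phi$ iff $\mathcal B(s)\subseteq\Vert\phi\Vert$. A schema (with metavariables ranging over $\Phi_0$) is valid on a frame if every instance is true at every state of every model based on that frame. -}

module Defs where

open import Data.Nat using (ℕ)
open import Data.Product using (Σ; ∃; _×_; _,_)
open import Data.Sum using (_⊎_)
open import Data.Empty using (⊥)
open import Relation.Nullary using (¬_)

At : Set
At = ℕ

data Φ₀ : Set where
  atom : At → Φ₀
  ¬'_  : Φ₀ → Φ₀
  _∨'_ : Φ₀ → Φ₀ → Φ₀

-- Boolean combinations of Φ₀-formulas and conditionals α > β (α β ∈ Φ₀);
-- these are the formulas that may occur under B.
data Φ₁ : Set where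
  base  : Φ₀ → Φ₁
  _>'_  : Φ₀ → Φ₀ → Φ₁
  ¬₁_   : Φ₁ → Φ₁
  _∨₁_  : Φ₁ → Φ₁ → Φ₁

Subset : Set → Set₁
Subset S = S → Set

_⊆_ : {S : Set} → Subset S → Subset S → Set
A ⊆ C = ∀ x → A x → C x

NonEmpty : {S : Set} → Subset S → Set
NonEmpty {S} E = Σ S E

-- Kripke-Lewis frame ⟨S, 𝓑, f⟩.  f is given on all subsets, but only its
-- values on nonempty subsets are ever used.  Since subsets are predicates,
-- f is required to respect extensional equality of subsets (so that it is a
-- genuine function on 2^S, as in the paper).
record Frame : Set₁ where
  field
    S      : Set
    𝓑      : S → S → Set
    serial : ∀ s → Σ S (λ s' → 𝓑 s s')
    f      : S → Subset S → Subset S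
    f-ext  : ∀ s (E E' : Subset S) → E ⊆ E' → E' ⊆ E → f s E ⊆ f s E'

module _ (F : Frame) where
  open Frame F

  Valuation : Set₁
  Valuation = At → Subset S

  ⟦_⟧₀ : Φ₀ → Valuation → Subset S
  ⟦ atom p ⟧₀ V s = V p s
  ⟦ ¬' φ ⟧₀ V s = ¬ (⟦ φ ⟧₀ V s)
  ⟦ φ ∨' ψ ⟧₀ V s = ⟦ φ ⟧₀ V s ⊎ ⟦ ψ ⟧₀ V s

  -- truth of Φ₁ formulas.  s ⊨ φ > ψ iff ‖φ‖ = ∅ or f(s,‖φ‖) ⊆ ‖ψ‖,
  -- rendered (classically equivalently) as: ‖φ‖ ≠ ∅ → f(s,‖φ‖) ⊆ ‖ψ‖.
  ⟦_⟧₁ : Φ₁ → Valuation → Subset S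
  ⟦ base φ ⟧₁ V s = ⟦ φ ⟧₀ V s
  ⟦ φ >' ψ ⟧₁ V s = NonEmpty (⟦ φ ⟧₀ V) → f s (⟦ φ ⟧₀ V) ⊆ ⟦ ψ ⟧₀ V
  ⟦ ¬₁ φ ⟧₁ V s = ¬ (⟦ φ ⟧₁ V s)
  ⟦ φ ∨₁ ψ ⟧₁ V s = ⟦ φ ⟧₁ V s ⊎ ⟦ ψ ⟧₁ V s

  ⟦B_⟧ : Φ₁ → Valuation → Subset S
  ⟦B φ ⟧ V s = ∀ s' → 𝓑 s s' → ⟦ φ ⟧₁ V s'

  ValidB-φ>φ : Set₁
  ValidB-φ>φ = ∀ (V : Valuation) (φ : Φ₀) (s : S) → ⟦B (φ >' φ) ⟧ V s

  P*2 : Set₁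
  P*2 = ∀ (s : S) (E : Subset S) → NonEmpty E → ∀ s' → 𝓑 s s' → f s' E ⊆ E

{-# OPTIONS --safe #-}
module Submission where

open import Defs
open import Data.Product using (_×_; _,_)
open import Relation.Nullary using (¬_; contraposition)

P*2⇒ValidB-φ>φ : (F : Frame) → P*2 F → ValidB-φ>φ F
P*2⇒ValidB-φ>φ F p*2 V φ s s' sℬs' ‖φ‖-nonempty = p*2 s (⟦_⟧₀ F φ V) ‖φ‖-nonempty s' sℬs'

-- Every subset E is the extension of an atom under the constant valuation
-- p ↦ E, so the instance B(p > p) already forces f(s', E) ⊆ E.
ValidB-φ>φ⇒P*2 : (F : Frame) → ValidB-φ>φ F → P*2 F
ValidB-φ>φ⇒P*2 F valid s E E-nonempty s' sℬs' = valid (λ _ → E) (atom 0) s s' sℬs' E-nonempty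

proposition1 : (F : Frame) → (P*2 F → ValidB-φ>φ F) × (¬ P*2 F → ¬ ValidB-φ>φ F)
proposition1 F = P*2⇒ValidB-φ>φ F , contraposition (ValidB-φ>φ⇒P*2 F)
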